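{- Let $n\ge 1$ and let $B_n$ be the hyperoctahedral group. For every linear order $K_n$ on the set $[-n,n]\setminus\{0\}$, \[\sum_{\sigma\in B_n} q^{\text{flag-major}(\sigma)}=\sum_{\sigma\in B_n} q^{\text{flag-major}_{K_n}(\sigma)}.\]
   Context: $B_n$ is the group (under composition) of all bijections $\sigma$ of $[-n,n]\setminus\{0\}$ with $\sigma(-a)=-\sigma(a)$ for all $a$; we write $\sigma=[\sigma(1),\dots,\sigma(n)]$. For a linear order $K$ on $[-n,n]\setminus\{0\}$, the descent set is $Des_K(\sigma)=\{1\le i\le n-1:\sigma(i)>_K\sigma(i+1)\}$ and $maj_K(\sigma)=\sum_{i\in Des_K(\sigma)} i$. Let $neg(\sigma)=|\{1\le i\le n:\sigma(i)<0\}|$. Define $\text{flag-major}_{K}(\sigma)=2\,maj_{K}(\sigma)+neg(\sigma)$, and $\text{flag-major}(\sigma)=\text{flag-major}_{A}(\sigma)$ where $A$ is the order $-1<-2<\dots<-n<1<2<\dots<n$. -}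

module Defs where

open import Data.Nat using (ℕ; zero; suc; _+_; _*_; _<_; _≟_)
open import Data.Nat.Properties using (<-cmp)
open import Data.Fin using (Fin; toℕ)
import Data.Fin.Properties as FinP
open import Data.List using (List; []; _∷_; map; concatMap; length; filter)
open import Data.Vec using (Vec; []; _∷_; toList)
open import Data.List.Relation.Unary.AllPairs using (AllPairs; allPairs?)
open import Relation.Binary.Core using (Rel)
open import Relation.Binary.Definitions using (Decidable)
open import Relation.Binary.PropositionalEquality using (_≡_)
open import Relation.Binary.Structures using (IsStrictTotalOrder)
open import Relation.Nullary using (Dec; yes; no; ¬_; ¬?)
open import Relation.Nullary.Decidable using (_×-dec_)
open import Data.Nat.ListAction using (sum)
open import Level using (0ℓ)

-- Elements of [-n,n] \ {0}:  pos i  stands for  +(i+1),  neg i  for  -(i+1).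
data Sgn (n : ℕ) : Set where
  pos : Fin n → Sgn n
  neg : Fin n → Sgn n

∣_∣ₛ : ∀ {n} → Sgn n → Fin n
∣ pos i ∣ₛ = i
∣ neg i ∣ₛ = i

isNeg : ∀ {n} → Sgn n → ℕ
isNeg (pos _) = 0
isNeg (neg _) = 1

-- A signed permutation σ ∈ B_n is determined by its window
-- [σ(1),…,σ(n)] (σ(-a) = -σ(a)); a window determines an element of B_n
-- iff the absolute values |σ(1)|,…,|σ(n)| are pairwise distinct.
Window : ℕ → Set
Window n = Vec (Sgn n) n

IsSignedPerm : ∀ {n} → Window n → Set
IsSignedPerm w = AllPairs (λ x y → ¬ (∣ x ∣ₛ ≡ ∣ y ∣ₛ)) (toList w)

isSignedPerm? : ∀ {n} (w : Window n) → Dec (IsSignedPerm w)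
isSignedPerm? w = allPairs? (λ x y → ¬? (∣ x ∣ₛ FinP.≟ ∣ y ∣ₛ)) (toList w)

allSgn : (n : ℕ) → List (Sgn n)
allSgn n = map pos (Data.List.allFin n) Data.List.++ map neg (Data.List.allFin n)

allVecs : (n m : ℕ) → List (Vec (Sgn n) m)
allVecs n zero    = [] ∷ []
allVecs n (suc m) = concatMap (λ x → map (x ∷_) (allVecs n m)) (allSgn n)

Bn : (n : ℕ) → List (Window n)
Bn n = filter isSignedPerm? (allVecs n n)

-- maj with respect to a (decidable) strict order _<K_:
-- descent at position i iff σ(i) >_K σ(i+1), i.e. σ(i+1) <_K σ(i).
-- majFrom _<?_ p x ys : x sits at position p, followed by ys
majFrom : ∀ {n} {_<K_ : Rel (Sgn n) 0ℓ} → Decidable _<K_ → ℕ → Sgn n → List (Sgn n) → ℕ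
majFrom _<?_ p x []       = 0
majFrom _<?_ p x (y ∷ xs) with y <? x
... | yes _ = p + majFrom _<?_ (suc p) y xs
... | no  _ = majFrom _<?_ (suc p) y xs

maj : ∀ {n} {_<K_ : Rel (Sgn n) 0ℓ} → Decidable _<K_ → Window n → ℕ
maj _<?_ []       = 0
maj _<?_ (x ∷ xs) = majFrom _<?_ 1 x (toList xs)

negCount : ∀ {n} → Window n → ℕ
negCount w = sum (map isNeg (toList w))

flagMajorWith : ∀ {n} {_<K_ : Rel (Sgn n) 0ℓ} → Decidable _<K_ → Window n → ℕ
flagMajorWith _<?_ w = 2 * maj _<?_ w + negCount w

flagMajorK : ∀ {n} {_<K_ : Rel (Sgn n) 0ℓ} → IsStrictTotalOrder _≡_ _<K_ → Window n → ℕ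
flagMajorK K = flagMajorWith (IsStrictTotalOrder._<?_ K)

-- The order A:  -1 < -2 < … < -n < 1 < 2 < … < n, via a rank function.
rankA : ∀ {n} → Sgn n → ℕ
rankA {n} (neg i) = toℕ i
rankA {n} (pos i) = n + toℕ i

_<A_ : ∀ {n} → Rel (Sgn n) 0ℓ
x <A y = rankA x < rankA y

_<A?_ : ∀ {n} → Decidable (_<A_ {n})
x <A? y = Data.Nat._<?_ (rankA x) (rankA y)

flagMajor : ∀ {n} → Window n → ℕ
flagMajor = flagMajorWith _<A?_

-- coefficient of q^k in  Σ_{σ ∈ B_n} q^{stat σ}
coeff : (n : ℕ) → (Window n → ℕ) → ℕ → ℕ
coeff n stat k = length (filter (λ w → stat w ≟ k) (Bn n))

{-# OPTIONS --safe #-}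

-- Let ≺₁ and ≺₂ be linear orders on [-n,n] \ {0}. Relabel the window of σ ∈ B_n along the order
-- isomorphism (S, ≺₁) ≅ (S, ≺₂), where S is the set of entries of σ: the entry of ≺₁-rank r in S
-- is replaced by the entry of ≺₂-rank r. The result is again in B_n with the same entry set, hence
-- the same neg, and its ≺₂-descents are exactly the ≺₁-descents of σ, hence the same maj.
-- Relabelling back from ≺₂ to ≺₁ inverts it, so this is a bijection of B_n carrying
-- flag-major_≺₁ to flag-major_≺₂; the theorem is the case ≺₁ = A.
module Submission where

open import Defs
open import Data.Nat using (ℕ; zero; suc; _+_; _*_; _≤_; _<_; _≟_)
open import Data.Nat.Properties
  using (<-irrefl; <-asym; <-≤-trans; <⇒≢; m≤m+n; +-cancelˡ-≡; <-cmp; ≤-reflexive)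
  renaming (<-trans to <ℕ-trans)
open import Data.Nat.ListAction.Properties using (sum-↭)
open import Data.Fin using (toℕ)
open import Data.Fin.Properties using (toℕ<n; toℕ-injective)
open import Data.List
  using (List; []; _∷_; map; length; filter; concatMap; cartesianProductWith; _++_; allFin; upTo)
open import Data.List.Properties
  using (length-map; length-filter; filter-notAll; length-upTo; map-∘; map-id-local)
open import Data.Vec using (Vec; toList; []; _∷_)
import Data.Vec as Vec
open import Data.Vec.Properties using (toList-map; toList-injective; cast-is-id; ∷-injective)
open import Data.List.Membership.Propositional using (_∈_; find)
open import Data.List.Membership.Propositional.Properties
  using (∈-filter⁺; ∈-filter⁻; ∈-map⁺; ∈-map⁻; ∈-++⁺ˡ; ∈-++⁺ʳ; ∈-allFin; ∈-upTo⁺; ∈-cartesianProductWith⁺)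
open import Data.List.Membership.Propositional.Properties.WithK using (unique∧set⇒bag)
open import Data.List.Relation.Unary.Any using (Any; here; there; any?)
import Data.List.Relation.Unary.Any as Any
open import Data.List.Relation.Unary.Any.Properties using (map⁻)
open import Data.List.Relation.Unary.All as All using (All; []; _∷_)
import Data.List.Relation.Unary.All.Properties as All
import Data.List.Relation.Unary.AllPairs as AllPairs
open AllPairs using ([]; _∷_)
open import Data.List.Relation.Unary.Unique.Propositional using (Unique)
import Data.List.Relation.Unary.Unique.Propositional.Properties as Unique
open import Data.List.Relation.Binary.Subset.Propositional using (_⊆_)
open import Data.List.Relation.Binary.Permutation.Propositional using (_↭_; ↭-sym; ↭⇒↭ₛ)
open import Data.List.Relation.Binary.Permutation.Propositional.Properties
  using (↭-length; filter-↭; ∈-resp-↭)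
  renaming (map⁺ to map-↭)
import Data.List.Relation.Binary.Permutation.Setoid.Properties as SetoidPermutation
open import Data.List.Relation.Binary.BagAndSetEquality using (∼bag⇒↭)
open import Data.Product using (_×_; _,_; proj₁; proj₂)
open import Function using (_∘_; _⇔_; mk⇔; Equivalence)
open import Relation.Nullary using (yes; no; ¬_; contradiction)
open import Relation.Binary.Core using (Rel)
open import Relation.Binary.Definitions using (Decidable; DecidableEquality; Tri; tri<; tri≈; tri>)
open import Relation.Binary.Structures using (IsStrictTotalOrder)
open import Relation.Binary.PropositionalEquality
  using (_≡_; refl; sym; trans; cong; cong₂; subst; subst₂; resp₂; setoid; isEquivalence; module ≡-Reasoning)
open import Level using (0ℓ)

module _ {A : Set} where

  unique-⊆-⊇⇒↭ : {xs ys : List A} → Unique xs → Unique ys → xs ⊆ ys → ys ⊆ xs → xs ↭ ys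
  unique-⊆-⊇⇒↭ xs! ys! xs⊆ys ys⊆xs = ∼bag⇒↭ (unique∧set⇒bag xs! ys! (mk⇔ xs⊆ys ys⊆xs))

  Unique-⊆⇒length≤ : DecidableEquality A → {xs ys : List A} → Unique xs → Unique ys → xs ⊆ ys →
    length xs ≤ length ys
  Unique-⊆⇒length≤ _≟ᴬ_ {xs} {ys} xs! ys! xs⊆ys = begin
    length xs                   ≡⟨ ↭-length xs↭ys∩xs ⟩
    length (filter (_∈? xs) ys) ≤⟨ length-filter (_∈? xs) ys ⟩
    length ys                   ∎
    where
      open import Data.List.Membership.DecPropositional _≟ᴬ_ using (_∈?_)
      open Data.Nat.Properties.≤-Reasoning
      xs↭ys∩xs : xs ↭ filter (_∈? xs) ys
      xs↭ys∩xs = unique-⊆-⊇⇒↭ xs! (Unique.filter⁺ (_∈? xs) {ys} ys!)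
        (λ x∈xs → ∈-filter⁺ (_∈? xs) (xs⊆ys x∈xs) x∈xs)
        (λ x∈ys∩xs → proj₂ (∈-filter⁻ (_∈? xs) {xs = ys} x∈ys∩xs))

  Unique-map⁺-injectiveOn : {B : Set} {f : A → B} {xs : List A} →
    (∀ {x y} → x ∈ xs → y ∈ xs → f x ≡ f y → x ≡ y) → Unique xs → Unique (map f xs)
  Unique-map⁺-injectiveOn inj [] = []
  Unique-map⁺-injectiveOn inj (x∉xs ∷ xs!) =
    All.map⁺ (All.tabulate λ y∈xs → All.lookup x∉xs y∈xs ∘ inj (here refl) (there y∈xs))
    ∷ Unique-map⁺-injectiveOn (λ x∈xs y∈xs → inj (there x∈xs) (there y∈xs)) xs!
module _ {A : Set} {L : List A} (L! : Unique L) {f g : A → A}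
         (f∈ : ∀ {x} → x ∈ L → f x ∈ L) (g∈ : ∀ {x} → x ∈ L → g x ∈ L)
         (gf : ∀ {x} → x ∈ L → g (f x) ≡ x) (fg : ∀ {x} → x ∈ L → f (g x) ≡ x) where

  length-filter-≟-bijection : (s t : A → ℕ) → (∀ {x} → x ∈ L → t (f x) ≡ s x) →
    ∀ k → length (filter (λ x → s x ≟ k) L) ≡ length (filter (λ x → t x ≟ k) L)
  length-filter-≟-bijection s t t∘f≡s k = begin
    length (filter S? L)         ≡⟨ length-map f (filter S? L) ⟨
    length (map f (filter S? L)) ≡⟨ ↭-length (unique-⊆-⊇⇒↭ fS! (Unique.filter⁺ T? L!) into onto) ⟩
    length (filter T? L)         ∎
    where
      open ≡-Reasoning
      S? = λ x → s x ≟ k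
      T? = λ x → t x ≟ k
      fS! : Unique (map f (filter S? L))
      fS! = Unique-map⁺-injectiveOn
        (λ {x} {y} x∈ y∈ fx≡fy → begin
          x         ≡⟨ gf (proj₁ (∈-filter⁻ S? {xs = L} x∈)) ⟨
          g (f x)   ≡⟨ cong g fx≡fy ⟩
          g (f y)   ≡⟨ gf (proj₁ (∈-filter⁻ S? {xs = L} y∈)) ⟩
          y         ∎)
        (Unique.filter⁺ S? {L} L!)
      into : map f (filter S? L) ⊆ filter T? L
      into z∈ with ∈-map⁻ f z∈
      ... | x , x∈ , refl = let x∈L , sx≡k = ∈-filter⁻ S? {xs = L} x∈ in
        ∈-filter⁺ T? (f∈ x∈L) (trans (t∘f≡s x∈L) sx≡k)
      onto : filter T? L ⊆ map f (filter S? L)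
      onto {y} y∈ = subst (_∈ map f (filter S? L)) (fg y∈L)
        (∈-map⁺ f (∈-filter⁺ S? (g∈ y∈L) (begin
          s (g y)     ≡⟨ t∘f≡s (g∈ y∈L) ⟨
          t (f (g y)) ≡⟨ cong t (fg y∈L) ⟩
          t y         ≡⟨ ty≡k ⟩
          k           ∎)))
        where
          y∈L = proj₁ (∈-filter⁻ T? {xs = L} y∈)
          ty≡k = proj₂ (∈-filter⁻ T? {xs = L} y∈)

concatMap-map≡cartesianProductWith : {A B C : Set} (f : A → B → C) (xs : List A) (ys : List B) →
  concatMap (λ x → map (f x) ys) xs ≡ cartesianProductWith f xs ys
concatMap-map≡cartesianProductWith f [] ys = refl
concatMap-map≡cartesianProductWith f (x ∷ xs) ys =
  cong (map (f x) ys ++_) (concatMap-map≡cartesianProductWith f xs ys)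

Unique-bounded⇒∈ : ∀ {m} {ns : List ℕ} → Unique ns → All (_< m) ns → m ≤ length ns → ∀ {r} → r < m → r ∈ ns
Unique-bounded⇒∈ {m} {ns} ns! ns<m m≤len {r} r<m with any? (r ≟_) ns
... | yes r∈ns = r∈ns
... | no r∉ns = contradiction r∷ns-fits (<-irrefl refl)
  where
    r∷ns! : Unique (r ∷ ns)
    r∷ns! = All.tabulate (λ n∈ns r≡n → r∉ns (subst (_∈ ns) (sym r≡n) n∈ns)) ∷ ns!
    r∷ns⊆upTo : r ∷ ns ⊆ upTo m
    r∷ns⊆upTo (here refl) = ∈-upTo⁺ r<m
    r∷ns⊆upTo (there n∈ns) = ∈-upTo⁺ (All.lookup ns<m n∈ns)
    r∷ns-fits : length (r ∷ ns) ≤ length ns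
    r∷ns-fits = begin
      length (r ∷ ns)     ≤⟨ Unique-⊆⇒length≤ _≟_ r∷ns! (Unique.upTo⁺ m) r∷ns⊆upTo ⟩
      length (upTo m)     ≡⟨ length-upTo m ⟩
      m                   ≤⟨ m≤len ⟩
      length ns           ∎
      where open Data.Nat.Properties.≤-Reasoning

module Rank {A : Set} {_≺_ : Rel A 0ℓ} (O : IsStrictTotalOrder _≡_ _≺_) where
  open IsStrictTotalOrder O using (compare; irrefl; _<?_) renaming (trans to ≺-trans; _≟_ to _≟ᴬ_)

  rank : A → List A → ℕ
  rank x xs = length (filter (_<? x) xs)

  rank<length : ∀ {x xs} → x ∈ xs → rank x xs < length xs
  rank<length {x} {xs} x∈xs = filter-notAll (_<? x) xs (Any.map (λ { refl → irrefl refl }) x∈xs)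

  rank-monotone : ∀ {x y xs} → Unique xs → x ∈ xs → x ≺ y → rank x xs < rank y xs
  rank-monotone {x} {y} {xs} xs! x∈xs x≺y =
    Unique-⊆⇒length≤ _≟ᴬ_ x∷below-x! (Unique.filter⁺ (_<? y) {xs} xs!) x∷below-x⊆below-y
    where
      x∷below-x! : Unique (x ∷ filter (_<? x) xs)
      x∷below-x! = All.tabulate (λ z∈ x≡z → irrefl (sym x≡z) (proj₂ (∈-filter⁻ (_<? x) {xs = xs} z∈)))
                   ∷ Unique.filter⁺ (_<? x) {xs} xs!
      x∷below-x⊆below-y : x ∷ filter (_<? x) xs ⊆ filter (_<? y) xs
      x∷below-x⊆below-y (here refl) = ∈-filter⁺ (_<? y) x∈xs x≺y
      x∷below-x⊆below-y (there z∈) =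
        let z∈xs , z≺x = ∈-filter⁻ (_<? x) {xs = xs} z∈ in ∈-filter⁺ (_<? y) z∈xs (≺-trans z≺x x≺y)

  rank-injective : ∀ {x y xs} → Unique xs → x ∈ xs → y ∈ xs → rank x xs ≡ rank y xs → x ≡ y
  rank-injective {x} {y} xs! x∈xs y∈xs eq with compare x y
  ... | tri< x≺y _ _ = contradiction eq (<⇒≢ (rank-monotone xs! x∈xs x≺y))
  ... | tri≈ _ x≡y _ = x≡y
  ... | tri> _ _ y≺x = contradiction (sym eq) (<⇒≢ (rank-monotone xs! y∈xs y≺x))

  rank-reflects-≺ : ∀ {x y xs} → Unique xs → y ∈ xs → rank x xs < rank y xs → x ≺ y
  rank-reflects-≺ {x} {y} xs! y∈xs lt with compare x y
  ... | tri< x≺y _ _ = x≺y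
  ... | tri≈ _ refl _ = contradiction lt (<-irrefl refl)
  ... | tri> _ _ y≺x = contradiction (rank-monotone xs! y∈xs y≺x) (<-asym lt)

  rank-resp-↭ : ∀ {x xs ys} → xs ↭ ys → rank x xs ≡ rank x ys
  rank-resp-↭ {x} xs↭ys = ↭-length (filter-↭ (_<? x) xs↭ys)

  rank-surjective : ∀ {xs r} → Unique xs → r < length xs → Any (λ y → rank y xs ≡ r) xs
  rank-surjective {xs} xs! r<len =
    Any.map sym (map⁻ (Unique-bounded⇒∈ ranks! ranks<length (≤-reflexive (sym (length-map _ xs))) r<len))
    where
      ranks! : Unique (map (λ y → rank y xs) xs)
      ranks! = Unique-map⁺-injectiveOn (rank-injective xs!) xs!
      ranks<length : All (_< length xs) (map (λ y → rank y xs) xs)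
      ranks<length = All.map⁺ (All.tabulate rank<length)

IsOrderEmbeddingOn : {A B : Set} → Rel A 0ℓ → Rel B 0ℓ → (A → B) → List A → Set
IsOrderEmbeddingOn _≺₁_ _≺₂_ f xs = ∀ {x y} → x ∈ xs → y ∈ xs → x ≺₁ y ⇔ f x ≺₂ f y

module Relabel {A : Set} {_≺₁_ _≺₂_ : Rel A 0ℓ}
               (O₁ : IsStrictTotalOrder _≡_ _≺₁_) (O₂ : IsStrictTotalOrder _≡_ _≺₂_) where
  private
    module R₁ = Rank O₁
    module R₂ = Rank O₂

  -- The fallback x is never reached when x ∈ xs and xs is duplicate-free (rank-surjective).
  relabel : List A → A → A
  relabel xs x with any? (λ y → R₂.rank y xs ≟ R₁.rank x xs) xs
  ... | yes y = proj₁ (find y)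
  ... | no _ = x

  relabel-spec : ∀ {x xs} → Unique xs → x ∈ xs →
    relabel xs x ∈ xs × R₂.rank (relabel xs x) xs ≡ R₁.rank x xs
  relabel-spec {x} {xs} xs! x∈xs with any? (λ y → R₂.rank y xs ≟ R₁.rank x xs) xs
  ... | yes y = proj₂ (find y)
  ... | no ¬y = contradiction (R₂.rank-surjective xs! (R₁.rank<length x∈xs)) ¬y

  relabel-∈ : ∀ {x xs} → Unique xs → x ∈ xs → relabel xs x ∈ xs
  relabel-∈ xs! x∈xs = proj₁ (relabel-spec xs! x∈xs)

  rank-relabel : ∀ {x xs} → Unique xs → x ∈ xs → R₂.rank (relabel xs x) xs ≡ R₁.rank x xs
  rank-relabel xs! x∈xs = proj₂ (relabel-spec xs! x∈xs)

  relabel-isOrderEmbedding : ∀ {xs} → Unique xs → IsOrderEmbeddingOn _≺₁_ _≺₂_ (relabel xs) xs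
  relabel-isOrderEmbedding xs! x∈xs y∈xs = mk⇔
    (λ x≺₁y → R₂.rank-reflects-≺ xs! (relabel-∈ xs! y∈xs)
                (subst₂ _<_ (sym (rank-relabel xs! x∈xs)) (sym (rank-relabel xs! y∈xs))
                  (R₁.rank-monotone xs! x∈xs x≺₁y)))
    (λ fx≺₂fy → R₁.rank-reflects-≺ xs! y∈xs
                (subst₂ _<_ (rank-relabel xs! x∈xs) (rank-relabel xs! y∈xs)
                  (R₂.rank-monotone xs! (relabel-∈ xs! x∈xs) fx≺₂fy)))

  relabel-resp-↭ : ∀ {x xs ys} → Unique xs → Unique ys → xs ↭ ys → x ∈ xs → relabel ys x ≡ relabel xs x
  relabel-resp-↭ {x} {xs} {ys} xs! ys! xs↭ys x∈xs = R₂.rank-injective xs!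
    (∈-resp-↭ (↭-sym xs↭ys) (relabel-∈ ys! (∈-resp-↭ xs↭ys x∈xs))) (relabel-∈ xs! x∈xs) (begin
      R₂.rank (relabel ys x) xs ≡⟨ R₂.rank-resp-↭ xs↭ys ⟩
      R₂.rank (relabel ys x) ys ≡⟨ rank-relabel ys! (∈-resp-↭ xs↭ys x∈xs) ⟩
      R₁.rank x ys              ≡⟨ R₁.rank-resp-↭ (↭-sym xs↭ys) ⟩
      R₁.rank x xs              ≡⟨ rank-relabel xs! x∈xs ⟨
      R₂.rank (relabel xs x) xs ∎)
    where open ≡-Reasoning

  relabel-injectiveOn : ∀ {x y xs} → Unique xs → x ∈ xs → y ∈ xs → relabel xs x ≡ relabel xs y → x ≡ y
  relabel-injectiveOn {x} {y} {xs} xs! x∈xs y∈xs eq = R₁.rank-injective xs! x∈xs y∈xs (begin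
    R₁.rank x xs              ≡⟨ rank-relabel xs! x∈xs ⟨
    R₂.rank (relabel xs x) xs ≡⟨ cong (λ z → R₂.rank z xs) eq ⟩
    R₂.rank (relabel xs y) xs ≡⟨ rank-relabel xs! y∈xs ⟩
    R₁.rank y xs              ∎)
    where open ≡-Reasoning

relabel-inverse : {A : Set} {_≺₁_ _≺₂_ : Rel A 0ℓ}
  (O₁ : IsStrictTotalOrder _≡_ _≺₁_) (O₂ : IsStrictTotalOrder _≡_ _≺₂_) →
  ∀ {x xs} → Unique xs → x ∈ xs → Relabel.relabel O₂ O₁ xs (Relabel.relabel O₁ O₂ xs x) ≡ x
relabel-inverse O₁ O₂ {x} {xs} xs! x∈xs = R₁.rank-injective xs! (From.relabel-∈ xs! y∈xs) x∈xs (begin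
  R₁.rank (From.relabel xs y) xs ≡⟨ From.rank-relabel xs! y∈xs ⟩
  R₂.rank y xs                   ≡⟨ To.rank-relabel xs! x∈xs ⟩
  R₁.rank x xs                   ∎)
  where
    module R₁ = Rank O₁
    module R₂ = Rank O₂
    module To = Relabel O₁ O₂
    module From = Relabel O₂ O₁
    open ≡-Reasoning
    y = To.relabel xs x
    y∈xs = To.relabel-∈ xs! x∈xs

map-relabel-↭ : {A : Set} {_≺₁_ _≺₂_ : Rel A 0ℓ}
  (O₁ : IsStrictTotalOrder _≡_ _≺₁_) (O₂ : IsStrictTotalOrder _≡_ _≺₂_) →
  ∀ {xs} → Unique xs → map (Relabel.relabel O₁ O₂ xs) xs ↭ xs
map-relabel-↭ O₁ O₂ {xs} xs! =
  unique-⊆-⊇⇒↭ (Unique-map⁺-injectiveOn (To.relabel-injectiveOn xs!) xs!) xs! into onto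
  where
    module To = Relabel O₁ O₂
    module From = Relabel O₂ O₁
    into : map (To.relabel xs) xs ⊆ xs
    into y∈ with ∈-map⁻ (To.relabel xs) y∈
    ... | x , x∈xs , refl = To.relabel-∈ xs! x∈xs
    onto : xs ⊆ map (To.relabel xs) xs
    onto {y} y∈xs = subst (_∈ map (To.relabel xs) xs) (relabel-inverse O₂ O₁ xs! y∈xs)
                      (∈-map⁺ (To.relabel xs) (From.relabel-∈ xs! y∈xs))

module _ {n : ℕ} {_≺₁_ _≺₂_ : Rel (Sgn n) 0ℓ} (d₁ : Decidable _≺₁_) (d₂ : Decidable _≺₂_)
         (f : Sgn n → Sgn n) where

  majFrom-map : ∀ p x ys → IsOrderEmbeddingOn _≺₁_ _≺₂_ f (x ∷ ys) →
    majFrom d₂ p (f x) (map f ys) ≡ majFrom d₁ p x ys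
  majFrom-map p x [] emb = refl
  majFrom-map p x (y ∷ ys) emb with d₁ y x | d₂ (f y) (f x)
  ... | yes _    | yes _     = cong (p +_) (majFrom-map (suc p) y ys (λ a∈ b∈ → emb (there a∈) (there b∈)))
  ... | no _     | no _      = majFrom-map (suc p) y ys (λ a∈ b∈ → emb (there a∈) (there b∈))
  ... | yes y≺₁x | no fy⊀₂fx = contradiction (Equivalence.to (emb (there (here refl)) (here refl)) y≺₁x) fy⊀₂fx
  ... | no y⊀₁x  | yes fy≺₂fx = contradiction (Equivalence.from (emb (there (here refl)) (here refl)) fy≺₂fx) y⊀₁x

  maj-map : (w : Window n) → IsOrderEmbeddingOn _≺₁_ _≺₂_ f (toList w) → maj d₂ (Vec.map f w) ≡ maj d₁ w
  maj-map [] emb = refl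
  maj-map (x ∷ xs) emb rewrite toList-map f xs = majFrom-map 1 x (toList xs) emb

module _ {n : ℕ} where

  IsSignedPerm⇒Unique : {w : Window n} → IsSignedPerm w → Unique (toList w)
  IsSignedPerm⇒Unique = AllPairs.map (λ ∣x∣≢∣y∣ x≡y → ∣x∣≢∣y∣ (cong ∣_∣ₛ x≡y))

  IsSignedPerm-resp-↭ : {v w : Window n} → toList v ↭ toList w → IsSignedPerm v → IsSignedPerm w
  IsSignedPerm-resp-↭ v↭w = AllPairs-resp-↭ (λ ∣x∣≢∣y∣ → ∣x∣≢∣y∣ ∘ sym) (resp₂ _) (↭⇒↭ₛ v↭w)
    where open SetoidPermutation (setoid (Sgn n)) using (AllPairs-resp-↭)

  negCount-resp-↭ : {v w : Window n} → toList v ↭ toList w → negCount v ≡ negCount w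
  negCount-resp-↭ v↭w = sum-↭ (map-↭ isNeg v↭w)

relabelWindow : ∀ {n} {_≺₁_ _≺₂_ : Rel (Sgn n) 0ℓ} →
  IsStrictTotalOrder _≡_ _≺₁_ → IsStrictTotalOrder _≡_ _≺₂_ → Window n → Window n
relabelWindow O₁ O₂ w = Vec.map (Relabel.relabel O₁ O₂ (toList w)) w

module _ {n : ℕ} {_≺₁_ _≺₂_ : Rel (Sgn n) 0ℓ}
         (O₁ : IsStrictTotalOrder _≡_ _≺₁_) (O₂ : IsStrictTotalOrder _≡_ _≺₂_) where
  private
    module To = Relabel O₁ O₂
    module From = Relabel O₂ O₁

  toList-relabelWindow : (w : Window n) →
    toList (relabelWindow O₁ O₂ w) ≡ map (To.relabel (toList w)) (toList w)
  toList-relabelWindow w = toList-map (To.relabel (toList w)) w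

  relabelWindow-↭ : {w : Window n} → IsSignedPerm w → toList (relabelWindow O₁ O₂ w) ↭ toList w
  relabelWindow-↭ {w} σ =
    subst (_↭ toList w) (sym (toList-relabelWindow w)) (map-relabel-↭ O₁ O₂ (IsSignedPerm⇒Unique σ))

  relabelWindow-isSignedPerm : {w : Window n} → IsSignedPerm w → IsSignedPerm (relabelWindow O₁ O₂ w)
  relabelWindow-isSignedPerm σ = IsSignedPerm-resp-↭ (↭-sym (relabelWindow-↭ σ)) σ

  relabelWindow-flagMajor : (d₁ : Decidable _≺₁_) (d₂ : Decidable _≺₂_) {w : Window n} → IsSignedPerm w →
    flagMajorWith d₂ (relabelWindow O₁ O₂ w) ≡ flagMajorWith d₁ w
  relabelWindow-flagMajor d₁ d₂ {w} σ = cong₂ (λ m ν → 2 * m + ν)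
    (maj-map d₁ d₂ (To.relabel (toList w)) w (To.relabel-isOrderEmbedding (IsSignedPerm⇒Unique σ)))
    (negCount-resp-↭ (relabelWindow-↭ σ))

  relabelWindow-inverse : {w : Window n} → IsSignedPerm w → relabelWindow O₂ O₁ (relabelWindow O₁ O₂ w) ≡ w
  relabelWindow-inverse {w} σ = trans (sym (cast-is-id refl _)) (toList-injective refl _ w (begin
    toList (relabelWindow O₂ O₁ v)              ≡⟨ toList-map (From.relabel ys) v ⟩
    map (From.relabel ys) ys                    ≡⟨ cong (map (From.relabel ys)) (toList-relabelWindow w) ⟩
    map (From.relabel ys) (map (To.relabel xs) xs) ≡⟨ map-∘ xs ⟨
    map (From.relabel ys ∘ To.relabel xs) xs    ≡⟨ map-id-local (All.tabulate back) ⟩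
    xs                                          ∎))
    where
      open ≡-Reasoning
      v = relabelWindow O₁ O₂ w
      xs = toList w
      ys = toList v
      xs! = IsSignedPerm⇒Unique σ
      ys! = IsSignedPerm⇒Unique (relabelWindow-isSignedPerm σ)
      back : ∀ {x} → x ∈ xs → From.relabel ys (To.relabel xs x) ≡ x
      back x∈xs = trans (From.relabel-resp-↭ xs! ys! (↭-sym (relabelWindow-↭ σ)) (To.relabel-∈ xs! x∈xs))
                        (relabel-inverse O₁ O₂ xs! x∈xs)

module _ {n : ℕ} where

  ∈-allSgn : (x : Sgn n) → x ∈ allSgn n
  ∈-allSgn (pos i) = ∈-++⁺ˡ (∈-map⁺ pos (∈-allFin i))
  ∈-allSgn (neg i) = ∈-++⁺ʳ (map pos (allFin n)) (∈-map⁺ neg (∈-allFin i))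

  allSgn-unique : Unique (allSgn n)
  allSgn-unique = Unique.++⁺ (Unique.map⁺ (λ { refl → refl }) (Unique.allFin⁺ n))
                             (Unique.map⁺ (λ { refl → refl }) (Unique.allFin⁺ n)) pos-neg-disjoint
    where
      pos-neg-disjoint : ∀ {x} → ¬ (x ∈ map pos (allFin n) × x ∈ map neg (allFin n))
      pos-neg-disjoint (x∈pos , x∈neg) with ∈-map⁻ pos x∈pos | ∈-map⁻ neg x∈neg
      ... | _ , _ , refl | _ , _ , ()

  allVecs-suc : ∀ m → allVecs n (suc m) ≡ cartesianProductWith _∷_ (allSgn n) (allVecs n m)
  allVecs-suc m = concatMap-map≡cartesianProductWith _∷_ (allSgn n) (allVecs n m)

  ∈-allVecs : ∀ {m} (v : Vec (Sgn n) m) → v ∈ allVecs n m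
  ∈-allVecs [] = here refl
  ∈-allVecs {suc m} (x ∷ v) =
    subst (x ∷ v ∈_) (sym (allVecs-suc m)) (∈-cartesianProductWith⁺ _∷_ (∈-allSgn x) (∈-allVecs v))

  allVecs-unique : ∀ m → Unique (allVecs n m)
  allVecs-unique zero = [] ∷ []
  allVecs-unique (suc m) = subst Unique (sym (allVecs-suc m))
    (Unique.cartesianProductWith⁺ _∷_ ∷-injective allSgn-unique (allVecs-unique m))

  Bn-unique : Unique (Bn n)
  Bn-unique = Unique.filter⁺ isSignedPerm? {allVecs n n} (allVecs-unique n)

  ∈-Bn⁺ : {w : Window n} → IsSignedPerm w → w ∈ Bn n
  ∈-Bn⁺ {w} σ = ∈-filter⁺ isSignedPerm? (∈-allVecs w) σ

  ∈-Bn⁻ : {w : Window n} → w ∈ Bn n → IsSignedPerm w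
  ∈-Bn⁻ w∈ = proj₂ (∈-filter⁻ isSignedPerm? {xs = allVecs n n} w∈)

flagMajorWith-equidistributed : ∀ {n} {_≺₁_ _≺₂_ : Rel (Sgn n) 0ℓ}
  (O₁ : IsStrictTotalOrder _≡_ _≺₁_) (d₁ : Decidable _≺₁_)
  (O₂ : IsStrictTotalOrder _≡_ _≺₂_) (d₂ : Decidable _≺₂_) →
  ∀ k → coeff n (flagMajorWith d₁) k ≡ coeff n (flagMajorWith d₂) k
flagMajorWith-equidistributed O₁ d₁ O₂ d₂ = length-filter-≟-bijection Bn-unique
  (∈-Bn⁺ ∘ relabelWindow-isSignedPerm O₁ O₂ ∘ ∈-Bn⁻) (∈-Bn⁺ ∘ relabelWindow-isSignedPerm O₂ O₁ ∘ ∈-Bn⁻)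
  (relabelWindow-inverse O₁ O₂ ∘ ∈-Bn⁻) (relabelWindow-inverse O₂ O₁ ∘ ∈-Bn⁻)
  (flagMajorWith d₁) (flagMajorWith d₂) (relabelWindow-flagMajor O₁ O₂ d₁ d₂ ∘ ∈-Bn⁻)

module _ {n : ℕ} where

  rankA-injective : {x y : Sgn n} → rankA x ≡ rankA y → x ≡ y
  rankA-injective {neg i} {neg j} eq = cong neg (toℕ-injective eq)
  rankA-injective {pos i} {pos j} eq = cong pos (toℕ-injective (+-cancelˡ-≡ n _ _ eq))
  rankA-injective {neg i} {pos j} eq = contradiction eq (<⇒≢ (<-≤-trans (toℕ<n i) (m≤m+n n (toℕ j))))
  rankA-injective {pos i} {neg j} eq = contradiction (sym eq) (<⇒≢ (<-≤-trans (toℕ<n j) (m≤m+n n (toℕ i))))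

  <A-isStrictTotalOrder : IsStrictTotalOrder _≡_ (_<A_ {n})
  <A-isStrictTotalOrder = record
    { isStrictPartialOrder = record
      { isEquivalence = isEquivalence
      ; irrefl = λ { refl → <-irrefl refl }
      ; trans = <ℕ-trans
      ; <-resp-≈ = resp₂ _<A_
      }
    ; compare = compare
    }
    where
      compare : (x y : Sgn n) → Tri (x <A y) (x ≡ y) (y <A x)
      compare x y with <-cmp (rankA x) (rankA y)
      ... | tri< x<y x≢y y≮x = tri< x<y (x≢y ∘ cong rankA) y≮x
      ... | tri≈ x≮y x≡y y≮x = tri≈ x≮y (rankA-injective x≡y) y≮x
      ... | tri> x≮y x≢y y<x = tri> x≮y (x≢y ∘ cong rankA) y<x

mainTheorem1 : (n : ℕ) → 1 ≤ n → (_<K_ : Rel (Sgn n) 0ℓ) → (K : IsStrictTotalOrder _≡_ _<K_) →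
    (k : ℕ) → coeff n flagMajor k ≡ coeff n (flagMajorK K) k
mainTheorem1 n _ _<K_ K =
  flagMajorWith-equidistributed <A-isStrictTotalOrder _<A?_ K (IsStrictTotalOrder._<?_ K)
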